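{- Let $H=(V,E)$ be a $k$-uniform hypergraph and let $K$ be a $2^k$-kernel of $H$. Then Waiter has a winning strategy in the Waiter-Client game on $H$ if and only if Waiter has a winning strategy in the Waiter-Client game on the trace hypergraph $T_K(H)=(K,\{e\cap K: e\in E\})$.
   Context: Waiter-Client game on a hypergraph: while at least two vertices are unclaimed, Waiter offers two unclaimed vertices to Client, who claims one; the other goes to Waiter; if the number of vertices is odd, the last vertex goes to Client. Waiter wins iff she claims all vertices of some edge. $H$ is $k$-uniform if all edges have exactly $k$ vertices. An $\ell$-sunflower of $H$ is a multiset $S$ of $\ell$ edges pairwise intersecting exactly in a fixed set $C$ (its center); its petals are the sets $s\setminus C$, $s\in S$; multisets are allowed, so a single edge repeated $\ell$ times is an $\ell$-sunflower. $S$ is outside $Y\subseteq V$ if all its petals are disjoint from $Y$. A set $K\subseteq V$ is an $\ell$-kernel of $H$ if for every edge $e\in E$ there exist $C\subseteq e\cap K$ and an $\ell$-sunflower of $H$ outside $K$ with center $C$. -}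

module Defs where

open import Data.Nat using (ℕ; _≤_)
open import Data.Fin using (Fin)
open import Data.Fin.Subset using (Subset; _∈_; _∉_; _⊆_; _∩_; _∪_; _-_; ⁅_⁆; ∣_∣; ⊤; ⊥)
open import Data.List using (List)
import Data.List
open import Data.List.Relation.Unary.All using (All)
open import Data.List.Relation.Unary.Any using (Any)
import Data.List.Membership.Propositional as LM
open import Data.Vec using (Vec; lookup)
open import Data.Product using (Σ; _×_)
open import Relation.Binary.PropositionalEquality using (_≡_; _≢_)

Edges : ℕ → Set
Edges n = List (Subset n)

Uniform : ∀ {n} → ℕ → Edges n → Set
Uniform k E = All (λ e → ∣ e ∣ ≡ k) E

-- A position is (F , W): F = set of unclaimed
-- vertices, W = set of vertices claimed by Waiter.
-- WaiterWinsFrom E F W : Waiter has a winning strategy from position (F , W).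
--  * end  : fewer than two vertices are unclaimed, so the game is over (any
--           remaining vertex goes to Client); Waiter wins iff she claimed all
--           vertices of some edge.
--  * offer: Waiter offers two distinct unclaimed vertices x , y, and wins
--           whichever one Client claims (the other going to Waiter).
data WaiterWinsFrom {n} (E : Edges n) : Subset n → Subset n → Set where
  end   : ∀ {F W} → ∣ F ∣ ≤ 1 → Any (λ e → e ⊆ W) E → WaiterWinsFrom E F W
  offer : ∀ {F W} (x y : Fin n) → x ∈ F → y ∈ F → x ≢ y
        → WaiterWinsFrom E ((F - x) - y) (W ∪ ⁅ y ⁆)   -- Client claims x
        → WaiterWinsFrom E ((F - x) - y) (W ∪ ⁅ x ⁆)   -- Client claims y
        → WaiterWinsFrom E F W

WaiterWins : ∀ {n} → Subset n → Edges n → Set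
WaiterWins B E = WaiterWinsFrom E B ⊥

traceEdges : ∀ {n} → Subset n → Edges n → Edges n
traceEdges K E = Data.List.map (λ e → e ∩ K) E

record Sunflower {n} (E : Edges n) (ℓ : ℕ) (C : Subset n) : Set where
  field
    petalsOf   : Vec (Subset n) ℓ
    areEdges   : ∀ i → lookup petalsOf i LM.∈ E
    centerIn   : ∀ i → C ⊆ lookup petalsOf i
    pairwise   : ∀ i j → i ≢ j → lookup petalsOf i ∩ lookup petalsOf j ≡ C

Outside : ∀ {n} {E : Edges n} {ℓ} {C : Subset n} → Sunflower E ℓ C → Subset n → Set
Outside {n} {C = C} S Y =
  ∀ i (x : Fin n) → x ∈ lookup (Sunflower.petalsOf S) i → x ∉ C → x ∉ Y

Kernel : ∀ {n} → ℕ → Edges n → Subset n → Set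
Kernel {n} ℓ E K =
  ∀ e → e LM.∈ E →
    Σ (Subset n) λ C → (C ⊆ e × C ⊆ K) ×
      Σ (Sunflower E ℓ C) λ S → Outside S K

{-# OPTIONS --safe #-}
-- From H to the trace, Waiter replays her strategy for H: an offer inside K is
-- copied, and when an offered vertex x lies outside K she pretends that Client
-- took the other one, so Waiter only gains x, which is invisible in the trace.
-- An edge e she completes in H leaves e ∩ K completed in the trace.
--
-- Conversely, she plays her trace strategy inside K, so every vertex outside K
-- stays free. Once she owns some e ∩ K she owns the centre of a 2^k-sunflower
-- whose petals avoid K. Given 2^(m+1) edges meeting only inside her own set,
-- each missing at most m+1 free vertices, Waiter pairs them up and offers one
-- missing vertex from each edge of a pair: Client's vertex spoils one edge of
-- the pair and lies in no other edge, while the other edge now misses at most m.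
-- Iterating leaves a single edge missing nothing.
module Submission where

open import Defs
open import Data.Nat using (ℕ; zero; suc; _≤_; _<_; _+_; _*_; _^_; z≤n; s≤s)
open import Data.Nat.Properties
  using ( module ≤-Reasoning; ≤-refl; ≤-reflexive; ≤-trans; <-≤-trans; ≤-<-trans; n≮0; m<1+n⇒m≤n
        ; *-suc; +-comm; +-assoc; +-monoʳ-≤; *-cancelˡ-<; *-distribˡ-+)
open import Data.Nat.Induction using (<-wellFounded)
open import Induction.WellFounded using (Acc; acc)
open import Data.Fin using (Fin)
open import Data.Fin.Properties using (_≟_)
open import Data.Fin.Subset using (Subset; _∈_; _∉_; _⊆_; _∩_; _∪_; _─_; _-_; ⁅_⁆; ∣_∣; ∁; ⊤; ⊥; outside)
open import Data.Fin.Subset.Properties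
open import Data.List using (List; []; _∷_; _++_; _∷ʳ_; length; tabulate)
open import Data.List.Properties using (length-++; length-tabulate; ++-assoc; ++-identityʳ)
open import Data.List.Relation.Unary.All as All using (All; []; _∷_)
import Data.List.Relation.Unary.All.Properties as All
open import Data.List.Relation.Unary.AllPairs as AllPairs using (AllPairs; []; _∷_)
import Data.List.Relation.Unary.AllPairs.Properties as AllPairs
open import Data.List.Relation.Unary.Any as Any using (Any)
import Data.List.Relation.Unary.Any.Properties as Any
import Data.List.Membership.Propositional as List
open import Data.List.Membership.Propositional using (lose; find)
open import Data.Vec using (lookup; _∷_)
open import Data.Vec.Base using (here; there)
open import Data.Product using (∃; ∃₂; _×_; _,_; proj₁; proj₂)
open import Data.Sum using (_⊎_; inj₁; inj₂)
open import Function.Bundles using (_⇔_; mk⇔)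
open import Relation.Binary.PropositionalEquality
  using (_≡_; _≢_; refl; sym; trans; cong; subst; module ≡-Reasoning)
open import Relation.Nullary using (yes; no)
open import Relation.Nullary.Negation using (contradiction)

private variable
  n : ℕ
  p q : Subset n
  x y : Fin n

x∈p─q⁻ : ∀ (p q : Subset n) → x ∈ p ─ q → x ∈ p × x ∉ q
x∈p─q⁻ p q x∈p─q = p─q⊆p p q x∈p─q , x∉q p q x∈p─q
  where
  x∉q : ∀ {n} {x : Fin n} (p q : Subset n) → x ∈ p ─ q → x ∉ q
  x∉q (_ ∷ p) (outside ∷ q) here ()
  x∉q (_ ∷ p) (_ ∷ q) (there x∈p─q) (there x∈q) = x∉q p q x∈p─q x∈q

x∈p-y⁻ : x ∈ p - y → x ∈ p × x ≢ y
x∈p-y⁻ {p = p} {y = y} x∈p-y with x∈p─q⁻ p ⁅ y ⁆ x∈p-y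
... | x∈p , x∉⁅y⁆ = x∈p , x∉⁅y⁆⇒x≢y x∉⁅y⁆

x∈p-y-z⁻ : ∀ {z} → x ∈ p - y - z → x ∈ p × x ≢ y × x ≢ z
x∈p-y-z⁻ x∈p-y-z with x∈p-y⁻ x∈p-y-z
... | x∈p-y , x≢z with x∈p-y⁻ x∈p-y
...   | x∈p , x≢y = x∈p , x≢y , x≢z

x∈p-y-z⁺ : ∀ {z} → x ∈ p → x ≢ y → x ≢ z → x ∈ p - y - z
x∈p-y-z⁺ x∈p x≢y x≢z = x∈p∧x≢y⇒x∈p-y (x∈p∧x≢y⇒x∈p-y x∈p x≢y) x≢z

p⊆q⇒p-x-y⊆q-x-y : p ⊆ q → p - x - y ⊆ q - x - y
p⊆q⇒p-x-y⊆q-x-y p⊆q v∈p-x-y with x∈p-y-z⁻ v∈p-x-y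
... | v∈p , v≢x , v≢y = x∈p-y-z⁺ (p⊆q v∈p) v≢x v≢y

p-x-y⊆p : p - x - y ⊆ p
p-x-y⊆p v∈p-x-y = proj₁ (x∈p-y-z⁻ v∈p-x-y)

q⊆r⇒p─r⊆p─q : ∀ {r} → q ⊆ r → p ─ r ⊆ p ─ q
q⊆r⇒p─r⊆p─q {q = q} {p = p} {r} q⊆r v∈p─r with x∈p─q⁻ p r v∈p─r
... | v∈p , v∉r = x∈p∧x∉q⇒x∈p─q v∈p (λ v∈q → v∉r (q⊆r v∈q))

p⊆q⇒p∩r⊆q∩r : ∀ {r} → p ⊆ q → p ∩ r ⊆ q ∩ r
p⊆q⇒p∩r⊆q∩r {p = p} {r = r} p⊆q v∈p∩r with x∈p∩q⁻ p r v∈p∩r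
... | v∈p , v∈r = x∈p∩q⁺ (p⊆q v∈p , v∈r)

∣p-x-y∣<∣p∣ : ∀ {p : Subset n} {x} y → x ∈ p → ∣ p - x - y ∣ < ∣ p ∣
∣p-x-y∣<∣p∣ {p = p} {x} y x∈p = ≤-<-trans (∣p─q∣≤∣p∣ (p - x) ⁅ y ⁆) (x∈p⇒∣p-x∣<∣p∣ x∈p)

x∈p∪⁅x⁆ : x ∈ p ∪ ⁅ x ⁆
x∈p∪⁅x⁆ {x = x} {p = p} = q⊆p∪q p ⁅ x ⁆ (x∈⁅x⁆ x)

x∈p∪⁅y⁆⁻ : x ∈ p ∪ ⁅ y ⁆ → x ∈ p ⊎ x ≡ y
x∈p∪⁅y⁆⁻ {p = p} {y = y} x∈p∪⁅y⁆ with x∈p∪q⁻ p ⁅ y ⁆ x∈p∪⁅y⁆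
... | inj₁ x∈p = inj₁ x∈p
... | inj₂ x∈⁅y⁆ = inj₂ (x∈⁅y⁆⇒x≡y y x∈⁅y⁆)

p⊆q⇒p∪⁅x⁆⊆q∪⁅x⁆ : p ⊆ q → p ∪ ⁅ x ⁆ ⊆ q ∪ ⁅ x ⁆
p⊆q⇒p∪⁅x⁆⊆q∪⁅x⁆ {q = q} p⊆q v∈p∪⁅x⁆ with x∈p∪⁅y⁆⁻ v∈p∪⁅x⁆
... | inj₁ v∈p = p⊆p∪q _ (p⊆q v∈p)
... | inj₂ refl = x∈p∪⁅x⁆ {p = q}

x∉r⇒[p∪⁅x⁆]∩r⊆p∩r : ∀ {r} → x ∉ r → (p ∪ ⁅ x ⁆) ∩ r ⊆ p ∩ r
x∉r⇒[p∪⁅x⁆]∩r⊆p∩r {p = p} {r = r} x∉r v∈ with x∈p∩q⁻ (p ∪ ⁅ _ ⁆) r v∈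
... | v∈p∪⁅x⁆ , v∈r with x∈p∪⁅y⁆⁻ v∈p∪⁅x⁆
...   | inj₁ v∈p = x∈p∩q⁺ (v∈p , v∈r)
...   | inj₂ refl = contradiction v∈r x∉r

[p∪⁅x⁆]∩r⊆[p∩r]∪⁅x⁆ : ∀ {r} → (p ∪ ⁅ x ⁆) ∩ r ⊆ (p ∩ r) ∪ ⁅ x ⁆
[p∪⁅x⁆]∩r⊆[p∩r]∪⁅x⁆ {p = p} {x = x} {r = r} v∈ with x∈p∩q⁻ (p ∪ ⁅ x ⁆) r v∈
... | v∈p∪⁅x⁆ , v∈r with x∈p∪⁅y⁆⁻ v∈p∪⁅x⁆
...   | inj₁ v∈p = p⊆p∪q ⁅ x ⁆ (x∈p∩q⁺ (v∈p , v∈r))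
...   | inj₂ refl = x∈p∪⁅x⁆ {p = p ∩ r}

[p-x-y]∩r⊆[p∩r]-x-y : ∀ {r} → (p - x - y) ∩ r ⊆ (p ∩ r) - x - y
[p-x-y]∩r⊆[p∩r]-x-y {p = p} {x = x} {y = y} {r = r} v∈ with x∈p∩q⁻ (p - x - y) r v∈
... | v∈p-x-y , v∈r with x∈p-y-z⁻ v∈p-x-y
...   | v∈p , v≢x , v≢y = x∈p-y-z⁺ (x∈p∩q⁺ (v∈p , v∈r)) v≢x v≢y

⊆⊎∃∉ : ∀ (p q : Subset n) → p ⊆ q ⊎ ∃ λ x → x ∈ p × x ∉ q
⊆⊎∃∉ p q with nonempty? (p ─ q)
... | yes (x , x∈p─q) = inj₂ (x , x∈p─q⁻ p q x∈p─q)
... | no p─q-empty = inj₁ p⊆q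
  where
  p⊆q : p ⊆ q
  p⊆q {x} x∈p with x ∈? q
  ... | yes x∈q = x∈q
  ... | no x∉q = contradiction (x , x∈p∧x∉q⇒x∈p─q x∈p x∉q) p─q-empty

∣p─q∣≤0⇒p⊆q : ∀ (p q : Subset n) → ∣ p ─ q ∣ ≤ 0 → p ⊆ q
∣p─q∣≤0⇒p⊆q p q ∣p─q∣≤0 with ⊆⊎∃∉ p q
... | inj₁ p⊆q = p⊆q
... | inj₂ (x , x∈p , x∉q) =
  contradiction (<-≤-trans (x∈p⇒∣p-x∣<∣p∣ (x∈p∧x∉q⇒x∈p─q x∈p x∉q)) ∣p─q∣≤0) n≮0

∣p∣≤1⊎∃distinct : ∀ (p : Subset n) → ∣ p ∣ ≤ 1 ⊎ ∃₂ λ x y → x ∈ p × y ∈ p × x ≢ y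
∣p∣≤1⊎∃distinct {n} p with nonempty? p
... | no p-empty =
  inj₁ (≤-trans (≤-reflexive (trans (cong ∣_∣ (Empty-unique p-empty)) (∣⊥∣≡0 n))) z≤n)
... | yes (x , x∈p) with nonempty? (p - x)
...   | yes (y , y∈p-x) with x∈p-y⁻ y∈p-x
...     | y∈p , y≢x = inj₂ (x , y , x∈p , y∈p , λ x≡y → y≢x (sym x≡y))
∣p∣≤1⊎∃distinct {n} p | yes (x , x∈p) | no p-x-empty =
  inj₁ (≤-trans (p⊆q⇒∣p∣≤∣q∣ p⊆⁅x⁆) (≤-reflexive (∣⁅x⁆∣≡1 x)))
  where
  p⊆⁅x⁆ : p ⊆ ⁅ x ⁆
  p⊆⁅x⁆ {y} y∈p with y ≟ x
  ... | yes refl = x∈⁅x⁆ x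
  ... | no y≢x = contradiction (y , x∈p∧x≢y⇒x∈p-y y∈p y≢x) p-x-empty

2*m≤2*n+1⇒m≤n : ∀ {m n} → 2 * m ≤ 2 * n + 1 → m ≤ n
2*m≤2*n+1⇒m≤n {m} {n} 2m≤2n+1 = m<1+n⇒m≤n (*-cancelˡ-< 2 m (suc n) 2m<2[1+n])
  where
  2m<2[1+n] : 2 * m < 2 * suc n
  2m<2[1+n] = ≤-trans (s≤s 2m≤2n+1) (≤-reflexive (trans (cong suc (+-comm (2 * n) 1)) (sym (*-suc 2 n))))

2*∣xs∷ʳx∣+k≡2*∣xs∣+2+k : ∀ {A : Set} (xs : List A) x k
  → 2 * length (xs ∷ʳ x) + k ≡ 2 * length xs + suc (suc k)
2*∣xs∷ʳx∣+k≡2*∣xs∣+2+k xs x k = begin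
  2 * length (xs ∷ʳ x) + k    ≡⟨ cong (λ l → 2 * l + k) (length-++ xs) ⟩
  2 * (length xs + 1) + k     ≡⟨ cong (_+ k) (*-distribˡ-+ 2 (length xs) 1) ⟩
  2 * length xs + 2 + k       ≡⟨ +-assoc (2 * length xs) 2 k ⟩
  2 * length xs + suc (suc k) ∎
  where open ≡-Reasoning

module _ {n} (E : Edges n) where

  OwnsEdge : Subset n → Set
  OwnsEdge W = Any (_⊆ W) E

  OwnsEdge-⊆ : ∀ {W W′} → W ⊆ W′ → OwnsEdge W → OwnsEdge W′
  OwnsEdge-⊆ {W} {W′} W⊆W′ = Any.map {P = _⊆ W} {Q = _⊆ W′} (λ e⊆W → ⊆-trans e⊆W W⊆W′)

  winsFromOwned : ∀ {F W} → OwnsEdge W → WaiterWinsFrom E F W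
  winsFromOwned {F} = go (<-wellFounded ∣ F ∣)
    where
    go : ∀ {F W} → Acc _<_ ∣ F ∣ → OwnsEdge W → WaiterWinsFrom E F W
    go {F} {W} (acc smaller) owns with ∣p∣≤1⊎∃distinct F
    ... | inj₁ ∣F∣≤1 = end ∣F∣≤1 owns
    ... | inj₂ (x , y , x∈F , y∈F , x≢y) =
      offer x y x∈F y∈F x≢y (continue (p⊆p∪q ⁅ y ⁆)) (continue (p⊆p∪q ⁅ x ⁆))
      where
      continue : ∀ {W′} → W ⊆ W′ → WaiterWinsFrom E (F - x - y) W′
      continue W⊆W′ = go (smaller (∣p-x-y∣<∣p∣ y x∈F)) (OwnsEdge-⊆ W⊆W′ owns)

  offerPair : ∀ {F W} x y → x ∈ F → y ∈ F → x ≢ y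
    → WaiterWinsFrom E (F - x - y) (W ∪ ⁅ y ⁆)
    → WaiterWinsFrom E (F - y - x) (W ∪ ⁅ x ⁆)
    → WaiterWinsFrom E F W
  offerPair {F} x y x∈F y∈F x≢y ifClientTakesX ifClientTakesY =
    offer x y x∈F y∈F x≢y ifClientTakesX
      (subst (λ G → WaiterWinsFrom E G _) (p─x─y≡p─y─x F y x) ifClientTakesY)

  record Live (m : ℕ) (F W e : Subset n) : Set where
    field
      isEdge  : e List.∈ E
      free    : e ─ W ⊆ F
      missing : ∣ e ─ W ∣ ≤ m

  open Live

  Live-⊆ : ∀ {m F W W′ e} → W ⊆ W′ → Live m F W e → Live m F W′ e
  Live-⊆ {e = e} W⊆W′ live = record
    { isEdge  = isEdge live
    ; free    = ⊆-trans e─W′⊆e─W (free live)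
    ; missing = ≤-trans (p⊆q⇒∣p∣≤∣q∣ e─W′⊆e─W) (missing live)
    }
    where
    e─W′⊆e─W = q⊆r⇒p─r⊆p─q {p = e} W⊆W′

  Live-claim : ∀ {m F W e w} → w ∈ e → w ∉ W → Live (suc m) F W e → Live m F (W ∪ ⁅ w ⁆) e
  Live-claim {m} {F} {W} {e} {w} w∈e w∉W live = record
    { isEdge  = isEdge live
    ; free    = free (Live-⊆ (p⊆p∪q ⁅ w ⁆) live)
    ; missing = m<1+n⇒m≤n (begin-strict
        ∣ e ─ (W ∪ ⁅ w ⁆) ∣ ≡⟨ cong ∣_∣ (p─q─r≡p─q∪r e W ⁅ w ⁆) ⟨
        ∣ e ─ W - w ∣        <⟨ x∈p⇒∣p-x∣<∣p∣ (x∈p∧x∉q⇒x∈p─q w∈e w∉W) ⟩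
        ∣ e ─ W ∣            ≤⟨ missing live ⟩
        suc m                ∎)
    }
    where open ≤-Reasoning

  Live-remove : ∀ {m F W e c w} → c ∉ e → w ∈ W → Live m F W e → Live m (F - c - w) W e
  Live-remove {W = W} {e} {c} {w} c∉e w∈W live = record
    { isEdge  = isEdge live
    ; free    = λ v∈e─W → x∈p-y-z⁺ (free live v∈e─W) (v≢c v∈e─W) (v≢w v∈e─W)
    ; missing = missing live
    }
    where
    v≢c : ∀ {v} → v ∈ e ─ W → v ≢ c
    v≢c v∈e─W refl = c∉e (proj₁ (x∈p─q⁻ e W v∈e─W))
    v≢w : ∀ {v} → v ∈ e ─ W → v ≢ w
    v≢w v∈e─W refl = proj₂ (x∈p─q⁻ e W v∈e─W) w∈W

  MeetIn : Subset n → Subset n → Subset n → Set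
  MeetIn W e f = e ∩ f ⊆ W

  MeetIn-sym : ∀ {W e f} → MeetIn W e f → MeetIn W f e
  MeetIn-sym {e = e} {f} e∩f⊆W = ⊆-trans (⊆-reflexive (∩-comm f e)) e∩f⊆W

  MeetIn-⊆ : ∀ {W W′ e f} → W ⊆ W′ → MeetIn W e f → MeetIn W′ e f
  MeetIn-⊆ W⊆W′ e∩f⊆W = ⊆-trans e∩f⊆W W⊆W′

  MeetIn-∉ : ∀ {W e f c} → MeetIn W e f → c ∈ e → c ∉ W → c ∉ f
  MeetIn-∉ e∩f⊆W c∈e c∉W c∈f = c∉W (e∩f⊆W (x∈p∩q⁺ (c∈e , c∈f)))

  AllPairs-MeetIn-∷ʳ : ∀ {W es s} → AllPairs (MeetIn W) es → All (MeetIn W s) es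
    → AllPairs (MeetIn W) (es ∷ʳ s)
  AllPairs-MeetIn-∷ʳ pairs row =
    AllPairs.++⁺ pairs ([] ∷ []) (All.map (λ meet → MeetIn-sym meet ∷ []) row)

  mutual
    winsFromFamily : ∀ m {F W} es → 2 ^ m ≤ length es
      → All (Live m F W) es → AllPairs (MeetIn W) es → WaiterWinsFrom E F W
    winsFromFamily zero {W = W} (e ∷ _) _ (live ∷ _) _ =
      winsFromOwned (lose (isEdge live) (∣p─q∣≤0⇒p⊆q e W (missing live)))
    winsFromFamily (suc m) es bound lives pairs =
      halveFamily m es [] bound lives [] (subst (AllPairs _) (sym (++-identityʳ es)) pairs)

    -- Each pair of pending edges leaves one survivor in done, so the weight
    -- 2 * length done + length pending never decreases.
    halveFamily : ∀ m {F W} pending done → 2 ^ suc m ≤ 2 * length done + length pending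
      → All (Live (suc m) F W) pending → All (Live m F W) done
      → AllPairs (MeetIn W) (pending ++ done) → WaiterWinsFrom E F W
    halveFamily m [] done bound _ lives pairs =
      winsFromFamily m done (2*m≤2*n+1⇒m≤n (≤-trans bound (+-monoʳ-≤ (2 * length done) z≤n))) lives pairs
    halveFamily m (_ ∷ []) done bound _ lives (_ ∷ pairs) =
      winsFromFamily m done (2*m≤2*n+1⇒m≤n bound) lives pairs
    halveFamily m {F} {W} (a ∷ b ∷ pending) done bound (live-a ∷ live-b ∷ lives) lives-done
                ((a∩b⊆W ∷ row-a) ∷ row-b ∷ pairs)
      with ⊆⊎∃∉ a W | ⊆⊎∃∉ b W
    ... | inj₁ a⊆W | _ = winsFromOwned (lose (isEdge live-a) a⊆W)
    ... | inj₂ _ | inj₁ b⊆W = winsFromOwned (lose (isEdge live-b) b⊆W)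
    ... | inj₂ (x , x∈a , x∉W) | inj₂ (y , y∈b , y∉W) =
      offerPair x y (free live-a (x∈p∧x∉q⇒x∈p─q x∈a x∉W)) (free live-b (x∈p∧x∉q⇒x∈p─q y∈b y∉W))
        x≢y
        (continueWith live-b y∈b y∉W x∈a x∉W a∩b⊆W row-a row-b)
        (continueWith live-a x∈a x∉W y∈b y∉W (MeetIn-sym a∩b⊆W) row-b row-a)
      where
      x≢y : x ≢ y
      x≢y refl = x∉W (a∩b⊆W (x∈p∩q⁺ (x∈a , y∈b)))

      -- Client has claimed c ∈ r, spoiling r; Waiter has claimed w ∈ s, so s survives.
      continueWith : ∀ {r s c w} → Live (suc m) F W s → w ∈ s → w ∉ W → c ∈ r → c ∉ W
        → MeetIn W r s
        → All (MeetIn W r) (pending ++ done) → All (MeetIn W s) (pending ++ done)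
        → WaiterWinsFrom E (F - c - w) (W ∪ ⁅ w ⁆)
      continueWith {r} {s} {c} {w} live-s w∈s w∉W c∈r c∉W r∩s⊆W row-r row-s with All.++⁻ pending row-r
      ... | row-r-pending , row-r-done =
        halveFamily m pending (done ∷ʳ s)
          (≤-trans bound (≤-reflexive (sym (2*∣xs∷ʳx∣+k≡2*∣xs∣+2+k done s (length pending)))))
          (All.zipWith stays (lives , row-r-pending))
          (All.∷ʳ⁺ (All.zipWith stays (lives-done , row-r-done))
                   (Live-remove (MeetIn-∉ r∩s⊆W c∈r c∉W) x∈p∪⁅x⁆ (Live-claim w∈s w∉W live-s)))
          (subst (AllPairs _) (++-assoc pending done (s ∷ []))
            (AllPairs.map (MeetIn-⊆ (p⊆p∪q ⁅ w ⁆)) (AllPairs-MeetIn-∷ʳ pairs row-s)))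
        where
        stays : ∀ {k e} → Live k F W e × MeetIn W r e → Live k (F - c - w) (W ∪ ⁅ w ⁆) e
        stays (live , r∩e⊆W) =
          Live-remove (MeetIn-∉ r∩e⊆W c∈r c∉W) x∈p∪⁅x⁆ (Live-⊆ (p⊆p∪q ⁅ w ⁆) live)

  winsFromSunflower : ∀ {k ℓ C F W} → Uniform k E → 2 ^ k ≤ ℓ → (S : Sunflower E ℓ C)
    → C ⊆ W → (∀ i → lookup (Sunflower.petalsOf S) i ─ C ⊆ F) → WaiterWinsFrom E F W
  winsFromSunflower {k} {ℓ} {C} {F} {W} uniform 2^k≤ℓ S C⊆W petalsFree =
    winsFromFamily k (tabulate edge) (≤-trans 2^k≤ℓ (≤-reflexive (sym (length-tabulate edge))))
      (All.tabulate⁺ live) (AllPairs.tabulate⁺ meet)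
    where
    open Sunflower S
    edge : Fin ℓ → Subset n
    edge = lookup petalsOf

    live : ∀ i → Live k F W (edge i)
    live i = record
      { isEdge  = areEdges i
      ; free    = ⊆-trans (q⊆r⇒p─r⊆p─q {p = edge i} C⊆W) (petalsFree i)
      ; missing = ≤-trans (∣p─q∣≤∣p∣ (edge i) W) (≤-reflexive (All.lookup uniform (areEdges i)))
      }

    meet : ∀ {i j} → i ≢ j → MeetIn W (edge i) (edge j)
    meet i≢j = ⊆-trans (⊆-reflexive (pairwise _ _ i≢j)) C⊆W

module _ {n} {E : Edges n} {K : Subset n} where

  full⇒trace : ∀ {F W F′ W′} → WaiterWinsFrom E F W → F ∩ K ⊆ F′ → W ∩ K ⊆ W′
    → WaiterWinsFrom (traceEdges K E) F′ W′
  full⇒trace {W = W} {W′ = W′} (end _ owns) _ W∩K⊆W′ =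
    winsFromOwned (traceEdges K E) (Any.map⁺ (Any.map {P = _⊆ W} {Q = λ e → e ∩ K ⊆ W′}
      (λ e⊆W → ⊆-trans (p⊆q⇒p∩r⊆q∩r e⊆W) W∩K⊆W′) owns))
  full⇒trace {F} {W} {F′} {W′} (offer x y x∈F y∈F x≢y ifClientTakesX ifClientTakesY) F∩K⊆F′ W∩K⊆W′
    with x ∈? K | y ∈? K
  ... | no x∉K | _ = full⇒trace ifClientTakesY
    (⊆-trans (p⊆q⇒p∩r⊆q∩r p-x-y⊆p) F∩K⊆F′) (⊆-trans (x∉r⇒[p∪⁅x⁆]∩r⊆p∩r x∉K) W∩K⊆W′)
  ... | yes _ | no y∉K = full⇒trace ifClientTakesX
    (⊆-trans (p⊆q⇒p∩r⊆q∩r p-x-y⊆p) F∩K⊆F′) (⊆-trans (x∉r⇒[p∪⁅x⁆]∩r⊆p∩r y∉K) W∩K⊆W′)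
  ... | yes x∈K | yes y∈K =
    offer x y (F∩K⊆F′ (x∈p∩q⁺ (x∈F , x∈K))) (F∩K⊆F′ (x∈p∩q⁺ (y∈F , y∈K))) x≢y
      (continue ifClientTakesX) (continue ifClientTakesY)
    where
    continue : ∀ {w} → WaiterWinsFrom E (F - x - y) (W ∪ ⁅ w ⁆)
      → WaiterWinsFrom (traceEdges K E) (F′ - x - y) (W′ ∪ ⁅ w ⁆)
    continue wins = full⇒trace wins
      (⊆-trans [p-x-y]∩r⊆[p∩r]-x-y (p⊆q⇒p-x-y⊆q-x-y F∩K⊆F′))
      (⊆-trans [p∪⁅x⁆]∩r⊆[p∩r]∪⁅x⁆ (p⊆q⇒p∪⁅x⁆⊆q∪⁅x⁆ W∩K⊆W′))

  module _ {k} (uniform : Uniform k E) (kernel : Kernel (2 ^ k) E K) where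

    trace⇒full : ∀ {F′ W′ F W} → WaiterWinsFrom (traceEdges K E) F′ W′
      → F′ ⊆ K → F′ ⊆ F → ∁ K ⊆ F → W′ ⊆ W → WaiterWinsFrom E F W
    trace⇒full {F = F} {W} (end _ owns) _ _ ∁K⊆F W′⊆W with find (Any.map⁻ owns)
    ... | e , e∈E , e∩K⊆W′ with kernel e e∈E
    ...   | C , (C⊆e , C⊆K) , S , outsideK = winsFromSunflower E uniform ≤-refl S C⊆W petalsFree
      where
      C⊆W : C ⊆ W
      C⊆W v∈C = W′⊆W (e∩K⊆W′ (x∈p∩q⁺ (C⊆e v∈C , C⊆K v∈C)))
      petalsFree : ∀ i → lookup (Sunflower.petalsOf S) i ─ C ⊆ F
      petalsFree i {v} v∈ with x∈p─q⁻ _ C v∈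
      ... | v∈edge , v∉C = ∁K⊆F (x∉p⇒x∈∁p (outsideK i v v∈edge v∉C))
    trace⇒full {F′} {W′} {F} {W} (offer x y x∈F′ y∈F′ x≢y ifClientTakesX ifClientTakesY) F′⊆K F′⊆F ∁K⊆F W′⊆W =
      offer x y (F′⊆F x∈F′) (F′⊆F y∈F′) x≢y (continue ifClientTakesX) (continue ifClientTakesY)
      where
      ∁K⊆F-x-y : ∁ K ⊆ F - x - y
      ∁K⊆F-x-y v∈∁K = x∈p-y-z⁺ (∁K⊆F v∈∁K) (v≢ x∈F′) (v≢ y∈F′)
        where
        v≢ : ∀ {u} → u ∈ F′ → _ ≢ u
        v≢ u∈F′ refl = x∈∁p⇒x∉p v∈∁K (F′⊆K u∈F′)

      continue : ∀ {w} → WaiterWinsFrom (traceEdges K E) (F′ - x - y) (W′ ∪ ⁅ w ⁆)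
        → WaiterWinsFrom E (F - x - y) (W ∪ ⁅ w ⁆)
      continue wins = trace⇒full wins
        (⊆-trans p-x-y⊆p F′⊆K) (p⊆q⇒p-x-y⊆q-x-y F′⊆F) ∁K⊆F-x-y (p⊆q⇒p∪⁅x⁆⊆q∪⁅x⁆ W′⊆W)

mainTheorem17 : (n k : ℕ) (E : Edges n) (K : Subset n)
    → Uniform k E → Kernel (2 ^ k) E K
    → WaiterWins ⊤ E ⇔ WaiterWins K (traceEdges K E)
mainTheorem17 _ _ _ K uniform kernel = mk⇔
  (λ wins → full⇒trace wins (p∩q⊆q ⊤ K) (p∩q⊆p ⊥ K))
  (λ wins → trace⇒full uniform kernel wins ⊆-refl ⊆⊤ ⊆⊤ ⊆-refl)
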